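{- Let $G=(V,E)$ be a graph with square $G^2=(V,E^2)$, and let $\sigma=(v_1,\ldots,v_n)$ be a maximum neighborhood ordering of $G$, where for every $1\le i<n$, $m_i$ is a maximum neighbor of $v_i$ in the graph $G_{\sigma,i}$ with $v_i\neq m_i$. If $1\le i<j\le n$ and $m_i\neq v_j$, then $v_iv_j\in E^2$ if and only if $m_iv_j\in E$.
   Context: All graphs are finite, simple and undirected. $N[v]$ denotes the closed neighborhood of $v$. The square $G^2=(V,E^2)$ has $uv\in E^2$ iff $u\neq v$ and either $uv\in E$ or $u,v$ have a common neighbor in $G$. For a total ordering $\sigma=(v_1,\ldots,v_n)$ of $V$, $G_{\sigma,i}$ is the subgraph of $G$ induced by $\{v_i,v_{i+1},\ldots,v_n\}$. In a graph $H$, a vertex $u\in N_H[v]$ is a maximum neighbor of $v$ if $N_H[x]\subseteq N_H[u]$ for all $x\in N_H[v]$. The ordering $\sigma$ is a maximum neighborhood ordering of $G$ if for every $i\in\{1,\ldots,n\}$, $v_i$ has a maximum neighbor in $G_{\sigma,i}$. -}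

module Defs where

open import Level using (0ℓ)
open import Data.Nat using (ℕ)
open import Data.Fin using (Fin; _≤_; _<_)
open import Data.Product using (Σ; ∃; ∃-syntax; _×_; _,_)
open import Data.Sum using (_⊎_)
open import Relation.Nullary using (¬_)
open import Relation.Binary.PropositionalEquality using (_≡_; _≢_)
open import Function.Definitions using (Bijective)

record Graph (n : ℕ) : Set₁ where
  field
    Adj     : Fin n → Fin n → Set
    sym     : ∀ {u v} → Adj u v → Adj v u
    irrefl  : ∀ {v} → ¬ Adj v v
open Graph public

Adj² : ∀ {n} → Graph n → Fin n → Fin n → Set
Adj² G u v = u ≢ v × (Adj G u v ⊎ ∃[ w ] (Adj G u w × Adj G w v))

-- A total ordering σ = (v_1,…,v_n) of V = Fin n: a bijection from positions to vertices.
Ordering : ℕ → Set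
Ordering n = Σ (Fin n → Fin n) λ σ → Bijective _≡_ _≡_ σ

-- Vertex set of G_{σ,i}: { v_i, v_{i+1}, …, v_n }.
Later : ∀ {n} → (Fin n → Fin n) → Fin n → Fin n → Set
Later σ i w = ∃[ k ] (i ≤ k × σ k ≡ w)

N[_∣_]_∋_ : ∀ {n} → Graph n → (Fin n → Set) → Fin n → Fin n → Set
N[ G ∣ P ] v ∋ u = P u × (u ≡ v ⊎ Adj G v u)

IsMaxNeighbor : ∀ {n} → Graph n → (Fin n → Set) → Fin n → Fin n → Set
IsMaxNeighbor G P v u =
  N[ G ∣ P ] v ∋ u ×
  (∀ x → N[ G ∣ P ] v ∋ x → ∀ y → N[ G ∣ P ] x ∋ y → N[ G ∣ P ] u ∋ y)

IsMNO : ∀ {n} → Graph n → Ordering n → Set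
IsMNO G (σ , _) = ∀ i → ∃[ u ] IsMaxNeighbor G (Later σ i) (σ i) u

-- If v_i and v_j share a neighbor v_k with k < i, both lie in the closed
-- neighborhood of v_k in G_{σ,k}, hence in that of m_k; so they are adjacent or
-- m_k, which comes strictly after v_k, is a new common neighbor. Repeating this
-- moves the common neighbor into G_{σ,i}, where maximality of m_i forces m_i v_j ∈ E.
module Submission where

open import Defs
import Data.Nat.Properties as ℕ
open import Data.Fin using (Fin; _<_; _>_)
open import Data.Fin.Properties using (_≤?_; <⇒≢; ≤∧≢⇒<)
open import Data.Fin.Induction using (>-wellFounded)
open import Data.Product using (Σ; ∃-syntax; _×_; _,_; proj₁; proj₂)
open import Data.Sum using (_⊎_; inj₁; inj₂)
open import Data.Empty using (⊥-elim)
open import Function using (_∘_)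
open import Function.Bundles using (_⇔_; mk⇔)
open import Function.Definitions using (Surjective)
open import Induction.WellFounded using (Acc; acc)
open import Relation.Nullary using (yes; no)
open import Relation.Binary.PropositionalEquality
  using (_≡_; _≢_; refl; cong; subst; trans) renaming (sym to ≡-sym)

module _ {n} (G : Graph n) where

  AdjOrCommonNeighborIn : (Fin n → Set) → Fin n → Fin n → Set
  AdjOrCommonNeighborIn P u v = Adj G u v ⊎ ∃[ w ] (P w × Adj G u w × Adj G w v)

  ∋∧≢⇒Adj : ∀ {P v u} → N[ G ∣ P ] v ∋ u → u ≢ v → Adj G v u
  ∋∧≢⇒Adj (_ , inj₁ u≡v) u≢v = ⊥-elim (u≢v u≡v)
  ∋∧≢⇒Adj (_ , inj₂ vu)  _   = vu

  maxNeighbor-adjacent : ∀ {P v u} → IsMaxNeighbor G P v u → v ≢ u → Adj G v u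
  maxNeighbor-adjacent {P} (u∈N[v] , _) v≢u = ∋∧≢⇒Adj {P} u∈N[v] (v≢u ∘ ≡-sym)

  maxNeighbor-adjacent-or-common : ∀ {P v u a b} → IsMaxNeighbor G P v u →
    N[ G ∣ P ] v ∋ a → N[ G ∣ P ] v ∋ b → a ≢ b →
    Adj G a b ⊎ (Adj G a u × Adj G u b)
  maxNeighbor-adjacent-or-common {P} {_} {u} {a} {b} (_ , dominates) a∈N[v] b∈N[v] a≢b =
    combine (dominates a a∈N[v] a (proj₁ a∈N[v] , inj₁ refl))
            (dominates b b∈N[v] b (proj₁ b∈N[v] , inj₁ refl))
    where
    combine : N[ G ∣ P ] u ∋ a → N[ G ∣ P ] u ∋ b → Adj G a b ⊎ (Adj G a u × Adj G u b)
    combine (_ , inj₁ a≡u) (_ , inj₁ b≡u) = ⊥-elim (a≢b (trans a≡u (≡-sym b≡u)))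
    combine (_ , inj₁ refl) (_ , inj₂ ub) = inj₁ ub
    combine (_ , inj₂ ua) (_ , inj₁ refl) = inj₁ (Graph.sym G ua)
    combine (_ , inj₂ ua) (_ , inj₂ ub)   = inj₂ (Graph.sym G ua , ub)

module _ {n} (G : Graph n) (σ : Fin n → Fin n) (m : Fin n → Fin n)
  (m-max : ∀ k → Σ (Fin n) (k <_) →
    IsMaxNeighbor G (Later σ k) (σ k) (m k) × σ k ≢ m k) where

  maxNeighbor-later : ∀ {k j} → k < j → ∃[ k′ ] (k < k′ × m k ≡ σ k′)
  maxNeighbor-later {k} {j} k<j with m-max k (j , k<j)
  ... | (((k′ , k≤k′ , σk′≡mk) , _) , _) , σk≢mk =
    k′ , ≤∧≢⇒< k≤k′ (σk≢mk ∘ λ k≡k′ → trans (cong σ k≡k′) σk′≡mk) , ≡-sym σk′≡mk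

  commonNeighbor-lift : ∀ {i j} → i < j → σ i ≢ σ j → ∀ k →
    Adj G (σ i) (σ k) → Adj G (σ k) (σ j) →
    AdjOrCommonNeighborIn G (Later σ i) (σ i) (σ j)
  commonNeighbor-lift {i} {j} i<j σi≢σj k = lift k (>-wellFounded k)
    where
    Goal : Set
    Goal = AdjOrCommonNeighborIn G (Later σ i) (σ i) (σ j)

    lift  : ∀ k → Acc _>_ k → Adj G (σ i) (σ k) → Adj G (σ k) (σ j) → Goal
    lift< : ∀ {k} → k < i → Acc _>_ k → Adj G (σ i) (σ k) → Adj G (σ k) (σ j) → Goal

    lift k rec σi-σk σk-σj with i ≤? k
    ... | yes i≤k = inj₂ (σ k , (k , i≤k , refl) , σi-σk , σk-σj)
    ... | no i≰k  = lift< (ℕ.≰⇒> i≰k) rec σi-σk σk-σj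

    lift< {k} k<i (acc later) σi-σk σk-σj
      with maxNeighbor-adjacent-or-common G (proj₁ (m-max k (j , k<j)))
             ((i , ℕ.<⇒≤ k<i , refl) , inj₂ (Graph.sym G σi-σk))
             ((j , ℕ.<⇒≤ k<j , refl) , inj₂ σk-σj) σi≢σj
         | maxNeighbor-later k<j
      where
      k<j : k < j
      k<j = ℕ.<-trans k<i i<j
    ... | inj₁ σi-σj | _ = inj₁ σi-σj
    ... | inj₂ (σi-mk , mk-σj) | k′ , k<k′ , mk≡σk′ =
      lift k′ (later k<k′) (subst (Adj G (σ i)) mk≡σk′ σi-mk)
                           (subst (λ w → Adj G w (σ j)) mk≡σk′ mk-σj)

  Adj²⇒AdjOrCommonNeighborIn : Surjective _≡_ _≡_ σ → ∀ {i j} → i < j → σ i ≢ σ j →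
    Adj² G (σ i) (σ j) → AdjOrCommonNeighborIn G (Later σ i) (σ i) (σ j)
  Adj²⇒AdjOrCommonNeighborIn _ _ _ (_ , inj₁ σi-σj) = inj₁ σi-σj
  Adj²⇒AdjOrCommonNeighborIn σ-surj i<j σi≢σj (_ , inj₂ (w , σi-w , w-σj))
    with σ-surj w
  ... | k , σk≡w = commonNeighbor-lift i<j σi≢σj k
    (subst (Adj G (σ _)) (≡-sym (σk≡w refl)) σi-w)
    (subst (λ u → Adj G u (σ _)) (≡-sym (σk≡w refl)) w-σj)

  AdjOrCommonNeighborIn⇒Adj-maxNeighbor : ∀ {i j} → i < j → m i ≢ σ j →
    AdjOrCommonNeighborIn G (Later σ i) (σ i) (σ j) → Adj G (m i) (σ j)
  AdjOrCommonNeighborIn⇒Adj-maxNeighbor {i} {j} i<j mi≢σj near =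
    ∋∧≢⇒Adj G {Later σ i} (σj∈N[mi] near) (mi≢σj ∘ ≡-sym)
    where
    σj-later : Later σ i (σ j)
    σj-later = j , ℕ.<⇒≤ i<j , refl
    dominates : ∀ x → N[ G ∣ Later σ i ] σ i ∋ x →
      ∀ y → N[ G ∣ Later σ i ] x ∋ y → N[ G ∣ Later σ i ] m i ∋ y
    dominates = proj₂ (proj₁ (m-max i (j , i<j)))
    σj∈N[mi] : AdjOrCommonNeighborIn G (Later σ i) (σ i) (σ j) →
      N[ G ∣ Later σ i ] m i ∋ σ j
    σj∈N[mi] (inj₁ σi-σj) =
      dominates (σ j) (σj-later , inj₂ σi-σj) (σ j) (σj-later , inj₁ refl)
    σj∈N[mi] (inj₂ (w , w-later , σi-w , w-σj)) =
      dominates w (w-later , inj₂ σi-w) (σ j) (σj-later , inj₂ w-σj)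

  Adj-maxNeighbor⇒Adj² : ∀ {i j} → i < j → σ i ≢ σ j →
    Adj G (m i) (σ j) → Adj² G (σ i) (σ j)
  Adj-maxNeighbor⇒Adj² {i} {j} i<j σi≢σj mi-σj =
    σi≢σj , inj₂ (m i , maxNeighbor-adjacent G (proj₁ mi-max) (proj₂ mi-max) , mi-σj)
    where
    mi-max : IsMaxNeighbor G (Later σ i) (σ i) (m i) × σ i ≢ m i
    mi-max = m-max i (j , i<j)

-- The IsMNO hypothesis is unused: the maximum neighbors m already carry all it provides.
lemma4 : ∀ {n} (G : Graph n) (σ : Ordering n) → IsMNO G σ →
    (m : Fin n → Fin n) →
    (∀ (i : Fin n) → Σ (Fin n) (λ j → i < j) →
      IsMaxNeighbor G (Later (proj₁ σ) i) (proj₁ σ i) (m i) × proj₁ σ i ≢ m i) →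
    ∀ (i j : Fin n) → i < j → m i ≢ proj₁ σ j →
      Adj² G (proj₁ σ i) (proj₁ σ j) ⇔ Adj G (m i) (proj₁ σ j)
lemma4 G (σ , σ-inj , σ-surj) _ m m-max i j i<j mi≢σj =
  mk⇔ (AdjOrCommonNeighborIn⇒Adj-maxNeighbor G σ m m-max i<j mi≢σj
        ∘ Adj²⇒AdjOrCommonNeighborIn G σ m m-max σ-surj i<j σi≢σj)
      (Adj-maxNeighbor⇒Adj² G σ m m-max i<j σi≢σj)
  where
  σi≢σj : σ i ≢ σ j
  σi≢σj = <⇒≢ i<j ∘ σ-inj
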